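{- Let $s$ and $t$ be non-negative integers. If $G\in\mathcal{G}$ is an $(s+t+1)$-triangular simple graph, then $G$ is $(s,t)$-supereulerian.
   Context: Graphs are finite and loopless (parallel edges allowed); a simple graph has no parallel edges. Let $J_1$ (resp. $J_2$) be obtained from $K_{1,3}$ by identifying two (resp. all three) of its degree-1 vertices. $\mathcal{G}$ is the family of connected graphs not isomorphic to a path, a cycle, $K_{1,3}$, $J_1$ or $J_2$. For an integer $k>0$, a graph is $k$-triangular if each of its edges lies in at least $k$ distinct triangles. A graph $G$ is $(s,t)$-supereulerian if for any disjoint $X,Y\subset E(G)$ with $|X|\le s$ and $|Y|\le t$, the graph obtained from $G$ by deleting the edges of $Y$ contains a spanning closed trail that traverses all edges of $X$. -}

module Defs where

open import Data.Nat using (ℕ; zero; suc; _≤_)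
open import Data.Fin using (Fin; zero; suc; inject₁; fromℕ)
open import Data.Fin.Subset using (Subset; _∈_; _∉_; ∣_∣)
open import Data.Product using (Σ; ∃; ∃-syntax; _×_; _,_; proj₁; proj₂)
open import Data.Sum using (_⊎_)
open import Data.List using (List; []; _∷_; _++_)
open import Data.List.Relation.Unary.Unique.Propositional using (Unique)
open import Data.List.Relation.Unary.All using (All)
import Data.List.Membership.Propositional as LM
open import Function.Bundles using (_⤖_; Bijection)
open import Function.Definitions using (Injective)
open import Relation.Binary.PropositionalEquality using (_≡_; _≢_)
open import Relation.Nullary using (¬_)
open import Data.Empty using (⊥)

-- Finite multigraphs: vertex set Fin nV, edge set Fin nE, each edge has
-- two (ordered-as-stored, but treated as unordered) endpoints.

record Graph : Set where
  field
    nV   : ℕ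
    nE   : ℕ
    ends : Fin nE → Fin nV × Fin nV
open Graph public

Vertex : Graph → Set
Vertex G = Fin (nV G)

Edge : Graph → Set
Edge G = Fin (nE G)

Joins : (G : Graph) → Edge G → Vertex G → Vertex G → Set
Joins G e x y = (proj₁ (ends G e) ≡ x × proj₂ (ends G e) ≡ y)
              ⊎ (proj₁ (ends G e) ≡ y × proj₂ (ends G e) ≡ x)

Loopless : Graph → Set
Loopless G = (e : Edge G) → proj₁ (ends G e) ≢ proj₂ (ends G e)

Simple : Graph → Set
Simple G = (e f : Edge G) → Joins G f (proj₁ (ends G e)) (proj₂ (ends G e)) → e ≡ f

data Walk (G : Graph) : Vertex G → Vertex G → Set where
  nil  : (x : Vertex G) → Walk G x x
  cons : {x z y : Vertex G} (e : Edge G) → Joins G e x z → Walk G z y → Walk G x y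

walkEdges : {G : Graph} {x y : Vertex G} → Walk G x y → List (Edge G)
walkEdges (nil x) = []
walkEdges (cons e _ w) = e ∷ walkEdges w

walkVertices : {G : Graph} {x y : Vertex G} → Walk G x y → List (Vertex G)
walkVertices (nil x) = x ∷ []
walkVertices {x = x} (cons e _ w) = x ∷ walkVertices w

Connected : Graph → Set
Connected G = (x y : Vertex G) → Walk G x y

record Iso (G H : Graph) : Set where
  field
    vmap : Vertex G ⤖ Vertex H
    emap : Edge G ⤖ Edge H
    incidence : (e : Edge G) →
      Joins H (Bijection.to emap e)
              (Bijection.to vmap (proj₁ (ends G e)))
              (Bijection.to vmap (proj₂ (ends G e)))

-- path on n vertices (P_0 is the empty graph; P_1 = K_1)
pathG : ℕ → Graph
pathG zero = record { nV = 0 ; nE = 0 ; ends = λ () }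
pathG (suc k) = record { nV = suc k ; nE = k ; ends = λ i → inject₁ i , suc i }

-- cycle on k+2 vertices (k+2 edges); C_2 is a pair of parallel edges
cycleG : ℕ → Graph
cycleG k = record { nV = suc (suc k) ; nE = suc (suc k) ; ends = en }
  where
  en : Fin (suc (suc k)) → Fin (suc (suc k)) × Fin (suc (suc k))
  en zero = zero , fromℕ (suc k)
  en (suc i) = inject₁ i , suc i

K13 : Graph
K13 = record { nV = 4 ; nE = 3 ; ends = λ i → zero , suc i }

-- J_1: K_{1,3} with two leaves identified: centre 0, leaves 1,2;
-- two parallel edges 0-1 and one edge 0-2
J1 : Graph
J1 = record { nV = 3 ; nE = 3 ; ends = en }
  where
  en : Fin 3 → Fin 3 × Fin 3
  en zero = zero , suc zero
  en (suc zero) = zero , suc zero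
  en (suc (suc _)) = zero , suc (suc zero)

-- J_2: K_{1,3} with all three leaves identified: three parallel edges 0-1
J2 : Graph
J2 = record { nV = 2 ; nE = 3 ; ends = λ _ → zero , suc zero }

InFamily : Graph → Set
InFamily G = Loopless G × Connected G
           × (∀ n → ¬ Iso G (pathG n))
           × (∀ k → ¬ Iso G (cycleG k))
           × ¬ Iso G K13 × ¬ Iso G J1 × ¬ Iso G J2

-- A triangle containing e (with ends (u , v)) is given by edges f, g and a
-- vertex w with f joining u,w and g joining v,w; the triangle is the edge
-- set {e, f, g}, which (for fixed e) is determined by the pair (f , g).
TriangleOn : (G : Graph) → Edge G → Set
TriangleOn G e = Σ (Edge G × Edge G) λ fg → ∃[ w ]
  (Joins G (proj₁ fg) (proj₁ (ends G e)) w × Joins G (proj₂ fg) (proj₂ (ends G e)) w)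

Triangular : ℕ → Graph → Set
Triangular k G = (e : Edge G) → Σ (Fin k → TriangleOn G e)
  λ t → Injective _≡_ _≡_ (λ i → proj₁ (t i))

SpanningClosedTrailThrough : (G : Graph) → Subset (nE G) → Subset (nE G) → Set
SpanningClosedTrailThrough G X Y = Σ (Vertex G) λ v → Σ (Walk G v v) λ w →
    Unique (walkEdges w)
  × All (λ e → e ∉ Y) (walkEdges w)
  × (∀ x → x LM.∈ walkVertices w)
  × (∀ e → e ∈ X → e LM.∈ walkEdges w)

Disjoint : {m : ℕ} → Subset m → Subset m → Set
Disjoint X Y = ∀ e → e ∈ X → e ∈ Y → ⊥

Supereulerian : ℕ → ℕ → Graph → Set
Supereulerian s t G = (X Y : Subset (nE G)) → Disjoint X Y → ∣ X ∣ ≤ s → ∣ Y ∣ ≤ t →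
  SpanningClosedTrailThrough G X Y

module Submission where

-- Since |X ∪ Y| ≤ s + t and, G being simple, distinct triangles on an edge e share no edge other
-- than e, every edge e lies in a triangle e f g with f, g ∉ X ∪ Y; in particular G − (X ∪ Y) is
-- connected.  Start from the spanning connected subgraph G − Y ⊇ X and pair up its odd vertices.
-- For two odd vertices p, q take a p–q walk in G − (X ∪ Y) and, edge by edge, change the parity
-- at the two ends of the current edge e: either toggle e itself, or toggle f and g, which has the
-- same effect on degree parities; one of these choices keeps the subgraph connected, spanning,
-- inside G − Y and containing X.  Once every degree is even, Hierholzer's construction yields a
-- closed trail through all of its edges, which is the required spanning closed trail.

open import Algebra.Bundles using (CommutativeRing)
open import Data.Bool using (Bool; true; false; not; _∧_; _∨_; _xor_; if_then_else_)
open import Data.Bool.Properties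
  using ( xor-assoc; xor-comm; xor-same; xor-identityʳ; xor-∧-commutativeRing; ∧-identityʳ; ∧-zeroʳ
        ; ∧-distribʳ-xor; ∧-conicalˡ; ∧-conicalʳ; ∨-conicalˡ; ∨-conicalʳ; ¬-not; not-¬; not-involutive)
  renaming (_≟_ to _≟ᵇ_)
open import Algebra.Properties.CommutativeSemigroup
  (CommutativeRing.+-commutativeSemigroup xor-∧-commutativeRing) using (interchange; xy∙z≈zx∙y)
open import Data.Empty using (⊥-elim)
open import Data.Fin using (Fin; zero; suc; _≟_)
open import Data.Fin.Properties using (suc-injective; any?)
open import Data.Fin.Subset using (Subset; ∣_∣)
open import Data.List using (List; []; _∷_; _++_)
import Data.List.Membership.DecPropositional as DecMembership
open import Data.List.Membership.Propositional using (_∈_; _∉_)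
open import Data.List.Membership.Propositional.Properties using (∈-++⁺ˡ; ∈-++⁺ʳ)
open import Data.List.Relation.Binary.Permutation.Propositional using (_↭_; ↭-sym; ↭⇒↭ₛ)
open import Data.List.Relation.Binary.Permutation.Propositional.Properties
  using (shifts; All-resp-↭; ∈-resp-↭)
import Data.List.Relation.Binary.Permutation.Setoid.Properties as SetoidPermutation
open import Data.List.Relation.Unary.All using (All; []; _∷_)
import Data.List.Relation.Unary.All as All
open import Data.List.Relation.Unary.All.Properties using (++⁺; ¬Any⇒All¬; All¬⇒¬Any)
open import Data.List.Relation.Unary.AllPairs using ([]; _∷_)
open import Data.List.Relation.Unary.Any using (here; there)
open import Data.List.Relation.Unary.Unique.Propositional using (Unique)
import Data.List.Relation.Unary.Unique.Propositional.Properties as Unique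
open import Data.Nat using (ℕ; zero; suc; _+_; _≤_; _<_; z≤n; s≤s)
open import Data.Nat.Induction using (<-wellFounded)
open import Data.Nat.Properties
  using ( +-comm; +-suc; +-mono-≤; ≤-trans; ≤-reflexive; <-≤-trans; <⇒≱; n<1+n; m≤n⇒m≤1+n
        ; module ≤-Reasoning)
open import Data.Product using (Σ; ∃; ∃-syntax; _×_; _,_; proj₁; proj₂; map₂)
open import Data.Sum using (_⊎_; inj₁; inj₂)
open import Data.Vec using ([]; _∷_; lookup)
open import Data.Vec.Properties using ([]=⇒lookup; lookup⇒[]=)
open import Function.Base using (_∘_; _⟨_⟩_; case_of_)
open import Function.Bundles using (_⤖_; mk⤖)
open import Function.Definitions using (Injective)
open import Induction.WellFounded using (Acc; acc)
open import Relation.Binary.PropositionalEquality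
open import Relation.Nullary using (¬_; contradiction; yes; no; does)
open import Relation.Nullary.Decidable using (dec-true; dec-false)

open import Defs

parity : ∀ {n} → (Fin n → Bool) → Bool
parity {zero}  f = false
parity {suc n} f = f zero xor parity (λ i → f (suc i))

count : ∀ {n} → (Fin n → Bool) → ℕ
count {zero}  f = 0
count {suc n} f = if f zero then suc (count (λ i → f (suc i))) else count (λ i → f (suc i))

toggle : ∀ {n} → Fin n → (Fin n → Bool) → Fin n → Bool
toggle i f j = f j xor does (i ≟ j)

-- The indicator of {a} △ {b}: the change of all degree parities caused by a walk from a to b.
boundary : ∀ {n} → Fin n → Fin n → Fin n → Bool
boundary a b v = does (a ≟ v) xor does (b ≟ v)

parity-cong : ∀ {n} {f g : Fin n → Bool} → (∀ i → f i ≡ g i) → parity f ≡ parity g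
parity-cong {zero}  f≗g = refl
parity-cong {suc n} f≗g = cong₂ _xor_ (f≗g zero) (parity-cong (λ i → f≗g (suc i)))

parity-false : ∀ {n} → parity {n} (λ _ → false) ≡ false
parity-false {zero}  = refl
parity-false {suc n} = parity-false {n}

parity-xor : ∀ {n} (f g : Fin n → Bool) → parity (λ i → f i xor g i) ≡ parity f xor parity g
parity-xor {zero}  f g = refl
parity-xor {suc n} f g =
  trans (cong ((f zero xor g zero) xor_) (parity-xor (λ i → f (suc i)) (λ i → g (suc i))))
        (interchange (f zero) (g zero) _ _)

parity-∧ˡ : ∀ {n} b (f : Fin n → Bool) → parity (λ i → b ∧ f i) ≡ b ∧ parity f
parity-∧ˡ true  f = refl
parity-∧ˡ {n} false f = parity-false {n}

parity-select : ∀ {n} (i : Fin n) (f : Fin n → Bool) → parity (λ j → does (i ≟ j) ∧ f j) ≡ f i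
parity-select {suc n} zero    f = trans (cong (f zero xor_) (parity-false {n})) (xor-identityʳ (f zero))
parity-select {suc n} (suc i) f = parity-select i (λ j → f (suc j))

parity-swap : ∀ {m n} (h : Fin m → Fin n → Bool) →
  parity (λ j → parity (λ i → h i j)) ≡ parity (λ i → parity (λ j → h i j))
parity-swap {m} {zero}  h = sym (parity-false {m})
parity-swap {m} {suc n} h =
  trans (cong (parity (λ i → h i zero) xor_) (parity-swap (λ i j → h i (suc j))))
        (sym (parity-xor (λ i → h i zero) (λ i → parity (λ j → h i (suc j)))))

parity-true⇒∃ : ∀ {n} (f : Fin n → Bool) → parity f ≡ true → ∃ λ i → f i ≡ true
parity-true⇒∃ {suc n} f odd with f zero in f₀
... | true  = zero , f₀
... | false with parity-true⇒∃ (λ i → f (suc i)) odd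
...   | i , fᵢ = suc i , fᵢ

toggle-self : ∀ {n} (i : Fin n) (f : Fin n → Bool) → toggle i f i ≡ not (f i)
toggle-self i f rewrite dec-true (i ≟ i) refl = xor-comm (f i) true

toggle-other : ∀ {n} {i j : Fin n} (f : Fin n → Bool) → i ≢ j → toggle i f j ≡ f j
toggle-other {i = i} {j} f i≢j rewrite dec-false (i ≟ j) i≢j = xor-identityʳ (f j)

toggle-keeps : ∀ {n} (i : Fin n) (f : Fin n → Bool) {j} → f j ≡ true → j ≢ i → toggle i f j ≡ true
toggle-keeps i f fⱼ j≢i = trans (toggle-other f (j≢i ∘ sym)) fⱼ

parity-indicator : ∀ {n} (i : Fin n) → parity (λ j → does (i ≟ j)) ≡ true
parity-indicator i =
  trans (parity-cong (λ j → sym (∧-identityʳ (does (i ≟ j))))) (parity-select i (λ _ → true))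

parity-toggle : ∀ {n} (i : Fin n) (f : Fin n → Bool) → parity (toggle i f) ≡ not (parity f)
parity-toggle i f = begin
  parity (λ j → f j xor does (i ≟ j))        ≡⟨ parity-xor f _ ⟩
  parity f xor parity (λ j → does (i ≟ j))   ≡⟨ cong (parity f xor_) (parity-indicator i) ⟩
  parity f xor true                          ≡⟨ xor-comm (parity f) true ⟩
  not (parity f)                             ∎
  where open ≡-Reasoning

parity-false⇒another : ∀ {n} (f : Fin n → Bool) {p} → parity f ≡ false → f p ≡ true →
  ∃ λ q → q ≢ p × f q ≡ true
parity-false⇒another f {p} even fp
  with parity-true⇒∃ (toggle p f) (trans (parity-toggle p f) (cong not even))
... | q , toggled with q ≟ p
...   | yes refl = contradiction (trans (sym toggled) (trans (toggle-self p f) (cong not fp))) λ ()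
...   | no q≢p   = q , q≢p , trans (sym (toggle-other f (q≢p ∘ sym))) toggled

count-cong : ∀ {n} {f g : Fin n → Bool} → (∀ i → f i ≡ g i) → count f ≡ count g
count-cong {zero}  f≗g = refl
count-cong {suc n} {f} f≗g
  rewrite f≗g zero | count-cong {f = λ i → f (suc i)} (λ i → f≗g (suc i)) = refl

count-mono : ∀ {n} {f g : Fin n → Bool} → (∀ i → f i ≡ true → g i ≡ true) → count f ≤ count g
count-mono {zero}  f⊆g = z≤n
count-mono {suc n} {f} {g} f⊆g with f zero in f₀ | g zero in g₀
... | true  | true  = s≤s (count-mono (λ i → f⊆g (suc i)))
... | true  | false = contradiction (trans (sym (f⊆g zero f₀)) g₀) λ ()
... | false | true  = m≤n⇒m≤1+n (count-mono (λ i → f⊆g (suc i)))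
... | false | false = count-mono (λ i → f⊆g (suc i))

count-toggle : ∀ {n} {f : Fin n → Bool} (i : Fin n) → f i ≡ true → count f ≡ suc (count (toggle i f))
count-toggle {suc n} {f} zero fᵢ rewrite fᵢ =
  cong suc (count-cong (λ j → sym (xor-identityʳ (f (suc j)))))
count-toggle {suc n} {f} (suc i) fᵢ with f zero
... | true  = cong suc (count-toggle i fᵢ)
... | false = count-toggle i fᵢ

count-strict : ∀ {n} {f g : Fin n → Bool} (i : Fin n) → (∀ j → f j ≡ true → g j ≡ true) →
  f i ≡ false → g i ≡ true → count f < count g
count-strict {f = f} {g} i f⊆g fᵢ gᵢ =
  s≤s (count-mono f⊆g-i) ⟨ <-≤-trans ⟩ ≤-reflexive (sym (count-toggle i gᵢ))
  where
  f⊆g-i : ∀ j → f j ≡ true → toggle i g j ≡ true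
  f⊆g-i j fⱼ with j ≟ i
  ... | yes refl = contradiction (trans (sym fᵢ) fⱼ) λ ()
  ... | no j≢i   = trans (toggle-other g (j≢i ∘ sym)) (f⊆g j fⱼ)

count-injection : ∀ {k n} {f : Fin n → Bool} (h : Fin k → Fin n) → Injective _≡_ _≡_ h →
  (∀ i → f (h i) ≡ true) → k ≤ count f
count-injection {zero}  h h-inj f∘h = z≤n
count-injection {suc k} {f = f} h h-inj f∘h =
  s≤s (count-injection (h ∘ suc) (suc-injective ∘ h-inj) rest)
    ⟨ ≤-trans ⟩ ≤-reflexive (sym (count-toggle (h zero) (f∘h zero)))
  where
  rest : ∀ i → toggle (h zero) f (h (suc i)) ≡ true
  rest i = trans (toggle-other f (λ eq → contradiction (h-inj eq) λ ())) (f∘h (suc i))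

count-∨ : ∀ {n} (f g : Fin n → Bool) → count (λ i → f i ∨ g i) ≤ count f + count g
count-∨ {zero}  f g = z≤n
count-∨ {suc n} f g with f zero | g zero | count-∨ (λ i → f (suc i)) (λ i → g (suc i))
... | true  | true  | ih = s≤s (m≤n⇒m≤1+n ih ⟨ ≤-trans ⟩ ≤-reflexive (sym (+-suc _ _)))
... | true  | false | ih = s≤s ih
... | false | true  | ih = s≤s ih ⟨ ≤-trans ⟩ ≤-reflexive (sym (+-suc _ _))
... | false | false | ih = ih

boundary-comm : ∀ {n} (a b v : Fin n) → boundary a b v ≡ boundary b a v
boundary-comm a b v = xor-comm (does (a ≟ v)) (does (b ≟ v))

boundary-refl : ∀ {n} (a v : Fin n) → boundary a a v ≡ false
boundary-refl a v = xor-same (does (a ≟ v))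

boundary-trans : ∀ {n} (a b c v : Fin n) → boundary a b v xor boundary b c v ≡ boundary a c v
boundary-trans a b c v = begin
  (x xor y) xor (y xor z)   ≡⟨ xor-assoc x y (y xor z) ⟩
  x xor (y xor (y xor z))   ≡⟨ cong (x xor_) (sym (xor-assoc y y z)) ⟩
  x xor ((y xor y) xor z)   ≡⟨ cong (λ u → x xor (u xor z)) (xor-same y) ⟩
  x xor z                   ∎
  where
  open ≡-Reasoning
  x = does (a ≟ v)
  y = does (b ≟ v)
  z = does (c ≟ v)

boundary-source : ∀ {n} {a b : Fin n} → a ≢ b → boundary a b a ≡ true
boundary-source {a = a} {b} a≢b rewrite dec-true (a ≟ a) refl | dec-false (b ≟ a) (a≢b ∘ sym) = refl

parity-boundary : ∀ {n} (a b : Fin n) → parity (boundary a b) ≡ false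
parity-boundary a b =
  trans (parity-xor (λ j → does (a ≟ j)) (λ j → does (b ≟ j)))
        (cong₂ _xor_ (parity-indicator a) (parity-indicator b))

count-boundary-xor : ∀ {n} {f : Fin n → Bool} {p q : Fin n} → q ≢ p → f p ≡ true → f q ≡ true →
  count (λ v → boundary p q v xor f v) < count f
count-boundary-xor {f = f} {p} {q} q≢p fp fq = begin-strict
  count (λ v → boundary p q v xor f v)
    ≡⟨ count-cong (λ v → xy∙z≈zx∙y (does (p ≟ v)) (does (q ≟ v)) (f v)) ⟩
  count (toggle q (toggle p f))
    <⟨ n<1+n _ ⟩
  suc (count (toggle q (toggle p f)))
    ≡⟨ count-toggle q (trans (toggle-other f (q≢p ∘ sym)) fq) ⟨
  count (toggle p f)
    <⟨ n<1+n _ ⟩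
  suc (count (toggle p f))
    ≡⟨ count-toggle p fp ⟨
  count f ∎
  where open ≤-Reasoning

descent : {A B : Set} (μ : A → ℕ) → (∀ a → B ⊎ Σ A λ a′ → μ a′ < μ a) → A → B
descent {A} {B} μ step a = go a (<-wellFounded (μ a))
  where
  go : ∀ a → Acc _<_ (μ a) → B
  go a (acc smaller) with step a
  ... | inj₁ b         = b
  ... | inj₂ (a′ , lt) = go a′ (smaller lt)

module Eulerian (G : Graph) where

  EdgeSet : Set
  EdgeSet = Edge G → Bool

  In : EdgeSet → Edge G → Set
  In Ω e = Ω e ≡ true

  open DecMembership (_≟_ {nE G}) using (_∈?_)
  open SetoidPermutation (setoid (Edge G)) using (Unique-resp-↭)

  WalkIn : (Edge G → Set) → Vertex G → Vertex G → Set
  WalkIn P a b = Σ (Walk G a b) λ w → All P (walkEdges w)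

  ends-joins : (e : Edge G) → Joins G e (proj₁ (ends G e)) (proj₂ (ends G e))
  ends-joins e = inj₁ (refl , refl)

  joins-sym : ∀ {e a b} → Joins G e a b → Joins G e b a
  joins-sym (inj₁ a,b) = inj₂ a,b
  joins-sym (inj₂ b,a) = inj₁ b,a

  joins-endpoints : ∀ {e a b x y} → Joins G e a b → Joins G e x y → (a ≡ x × b ≡ y) ⊎ (a ≡ y × b ≡ x)
  joins-endpoints (inj₁ (refl , refl)) (inj₁ (refl , refl)) = inj₁ (refl , refl)
  joins-endpoints (inj₁ (refl , refl)) (inj₂ (refl , refl)) = inj₂ (refl , refl)
  joins-endpoints (inj₂ (refl , refl)) (inj₁ (refl , refl)) = inj₂ (refl , refl)
  joins-endpoints (inj₂ (refl , refl)) (inj₂ (refl , refl)) = inj₁ (refl , refl)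

  _++ʷ_ : ∀ {a b c} → Walk G a b → Walk G b c → Walk G a c
  nil _      ++ʷ w′ = w′
  cons e j w ++ʷ w′ = cons e j (w ++ʷ w′)

  walkEdges-++ : ∀ {a b c} (w : Walk G a b) (w′ : Walk G b c) →
    walkEdges (w ++ʷ w′) ≡ walkEdges w ++ walkEdges w′
  walkEdges-++ (nil _)      w′ = refl
  walkEdges-++ (cons e j w) w′ = cong (e ∷_) (walkEdges-++ w w′)

  source∈walkVertices : ∀ {a b} (w : Walk G a b) → a ∈ walkVertices w
  source∈walkVertices (nil _)      = here refl
  source∈walkVertices (cons _ _ _) = here refl

  endpoint∈walkVertices : ∀ {a b d x y} (w : Walk G a b) → d ∈ walkEdges w → Joins G d x y →
    y ∈ walkVertices w
  endpoint∈walkVertices (cons e j w) (here refl) j′ with joins-endpoints j′ j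
  ... | inj₁ (_ , refl) = there (source∈walkVertices w)
  ... | inj₂ (_ , refl) = here refl
  endpoint∈walkVertices (cons e j w) (there d∈w) j′ = there (endpoint∈walkVertices w d∈w j′)

  split-at : ∀ {a b c} (w : Walk G a b) → c ∈ walkVertices w →
    Σ (Walk G a c) λ w₁ → Σ (Walk G c b) λ w₂ → walkEdges w₁ ++ walkEdges w₂ ≡ walkEdges w
  split-at (nil a)      (here refl)  = nil a , nil a , refl
  split-at (cons e j w) (here refl)  = nil _ , cons e j w , refl
  split-at (cons e j w) (there c∈w) with split-at w c∈w
  ... | w₁ , w₂ , eq = cons e j w₁ , w₂ , cong (e ∷_) eq

  splice : ∀ {a b c} (w : Walk G a b) → c ∈ walkVertices w → (d : Walk G c c) →
    Σ (Walk G a b) λ w′ → walkEdges w′ ↭ walkEdges d ++ walkEdges w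
  splice w c∈w d with split-at w c∈w
  ... | w₁ , w₂ , w₁w₂≡w = w₁ ++ʷ (d ++ʷ w₂) , edges↭
    where
    edges↭ : walkEdges (w₁ ++ʷ (d ++ʷ w₂)) ↭ walkEdges d ++ walkEdges w
    edges↭ rewrite walkEdges-++ w₁ (d ++ʷ w₂) | walkEdges-++ d w₂ | sym w₁w₂≡w =
      shifts (walkEdges w₁) (walkEdges d)

  module _ {P : Edge G → Set} where

    _++ᵂ_ : ∀ {a b c} → WalkIn P a b → WalkIn P b c → WalkIn P a c
    (w , w⊆P) ++ᵂ (w′ , w′⊆P) = w ++ʷ w′ , subst (All P) (sym (walkEdges-++ w w′)) (++⁺ w⊆P w′⊆P)

    reverseᵂ : ∀ {a b} → WalkIn P a b → WalkIn P b a
    reverseᵂ (nil a , [])           = nil a , []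
    reverseᵂ (cons e j w , pe ∷ ps) = reverseᵂ (w , ps) ++ᵂ (cons e (joins-sym j) (nil _) , pe ∷ [])

  reroute : ∀ {P Q : Edge G → Set} {d p q} → Joins G d p q → WalkIn Q p q →
    (∀ e → P e → e ≢ d → Q e) → ∀ {a b} → WalkIn P a b → WalkIn Q a b
  reroute jd detour P⇒Q (nil a , []) = nil a , []
  reroute {d = d} jd detour P⇒Q (cons e j w , pe ∷ ps) with e ≟ d | reroute jd detour P⇒Q (w , ps)
  ... | no e≢d   | rest = (cons e j (nil _) , P⇒Q e pe e≢d ∷ []) ++ᵂ rest
  ... | yes refl | rest with joins-endpoints j jd
  ...   | inj₁ (refl , refl) = detour ++ᵂ rest
  ...   | inj₂ (refl , refl) = reverseᵂ detour ++ᵂ rest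

  incidence : Edge G → Vertex G → Bool
  incidence e = boundary (proj₁ (ends G e)) (proj₂ (ends G e))

  incidence-joins : ∀ {e a b} → Joins G e a b → ∀ v → incidence e v ≡ boundary a b v
  incidence-joins (inj₁ (refl , refl)) v = refl
  incidence-joins {e} (inj₂ (refl , refl)) v = boundary-comm (proj₁ (ends G e)) (proj₂ (ends G e)) v

  incidence-true⇒joins : ∀ e x → incidence e x ≡ true → ∃ λ y → Joins G e x y
  incidence-true⇒joins e x inc with proj₁ (ends G e) ≟ x
  ... | yes refl = proj₂ (ends G e) , ends-joins e
  ... | no _ with proj₂ (ends G e) ≟ x
  ...   | yes refl = proj₁ (ends G e) , joins-sym (ends-joins e)
  ...   | no _     = contradiction inc λ ()

  oddDegree : EdgeSet → Vertex G → Bool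
  oddDegree Ω v = parity (λ e → Ω e ∧ incidence e v)

  Even : EdgeSet → Set
  Even Ω = ∀ v → oddDegree Ω v ≡ false

  oddDegree-cong : ∀ {Ω Ω′} → (∀ e → Ω e ≡ Ω′ e) → ∀ v → oddDegree Ω v ≡ oddDegree Ω′ v
  oddDegree-cong Ω≗Ω′ v = parity-cong (λ e → cong (_∧ incidence e v) (Ω≗Ω′ e))

  oddDegree-toggle : ∀ i Ω v → oddDegree (toggle i Ω) v ≡ incidence i v xor oddDegree Ω v
  oddDegree-toggle i Ω v = begin
    parity (λ e → (Ω e xor does (i ≟ e)) ∧ incidence e v)
      ≡⟨ parity-cong (λ e → ∧-distribʳ-xor (incidence e v) (Ω e) (does (i ≟ e))) ⟩
    parity (λ e → (Ω e ∧ incidence e v) xor (does (i ≟ e) ∧ incidence e v))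
      ≡⟨ parity-xor (λ e → Ω e ∧ incidence e v) (λ e → does (i ≟ e) ∧ incidence e v) ⟩
    oddDegree Ω v xor parity (λ e → does (i ≟ e) ∧ incidence e v)
      ≡⟨ cong (oddDegree Ω v xor_) (parity-select i (λ e → incidence e v)) ⟩
    oddDegree Ω v xor incidence i v
      ≡⟨ xor-comm (oddDegree Ω v) (incidence i v) ⟩
    incidence i v xor oddDegree Ω v ∎
    where open ≡-Reasoning

  handshake : ∀ Ω → parity (oddDegree Ω) ≡ false
  handshake Ω = begin
    parity (λ v → parity (λ e → Ω e ∧ incidence e v))
      ≡⟨ parity-swap (λ e v → Ω e ∧ incidence e v) ⟩
    parity (λ e → parity (λ v → Ω e ∧ incidence e v))
      ≡⟨ parity-cong (λ e → parity-∧ˡ (Ω e) (incidence e)) ⟩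
    parity (λ e → Ω e ∧ parity (incidence e))
      ≡⟨ parity-cong (λ e → cong (Ω e ∧_) (parity-boundary (proj₁ (ends G e)) (proj₂ (ends G e)))) ⟩
    parity (λ e → Ω e ∧ false)
      ≡⟨ parity-cong (λ e → ∧-zeroʳ (Ω e)) ⟩
    parity {nE G} (λ _ → false)
      ≡⟨ parity-false {nE G} ⟩
    false ∎
    where open ≡-Reasoning

  _∖_ : EdgeSet → List (Edge G) → EdgeSet
  (Ω ∖ L) e = Ω e ∧ not (does (e ∈? L))

  ∖-true⇒ : ∀ Ω L {e} → (Ω ∖ L) e ≡ true → Ω e ≡ true × e ∉ L
  ∖-true⇒ Ω L {e} unused with e ∈? L
  ... | yes _  = contradiction (trans (sym unused) (∧-zeroʳ (Ω e))) λ ()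
  ... | no e∉L = trans (sym (∧-identityʳ (Ω e))) unused , e∉L

  ∖-intro : ∀ Ω L {e} → Ω e ≡ true → e ∉ L → (Ω ∖ L) e ≡ true
  ∖-intro Ω L {e} Ωe e∉L rewrite dec-false (e ∈? L) e∉L = trans (∧-identityʳ (Ω e)) Ωe

  ∖-∈ : ∀ Ω L {e} → e ∈ L → (Ω ∖ L) e ≡ false
  ∖-∈ Ω L {e} e∈L rewrite dec-true (e ∈? L) e∈L = ∧-zeroʳ (Ω e)

  ∖-antitone : ∀ Ω {L} L′ → (∀ {e} → e ∈ L → e ∈ L′) → ∀ e → (Ω ∖ L′) e ≡ true → (Ω ∖ L) e ≡ true
  ∖-antitone Ω {L} L′ L⊆L′ e unused with ∖-true⇒ Ω L′ unused
  ... | Ωe , e∉L′ = ∖-intro Ω L Ωe (e∉L′ ∘ L⊆L′)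

  ∖-∷ : ∀ Ω L {e} → Ω e ≡ true → e ∉ L → ∀ e′ → (Ω ∖ (e ∷ L)) e′ ≡ toggle e (Ω ∖ L) e′
  ∖-∷ Ω L {e} Ωe e∉L e′ with e′ ≟ e
  ... | yes refl =
    trans (∧-zeroʳ (Ω e)) (sym (trans (toggle-self e (Ω ∖ L)) (cong not (∖-intro Ω L Ωe e∉L))))
  ... | no e′≢e  = sym (toggle-other (Ω ∖ L) (e′≢e ∘ sym))

  oddDegree-∖-trail : ∀ Ω {a b} (w : Walk G a b) → Unique (walkEdges w) → All (In Ω) (walkEdges w) →
    ∀ v → oddDegree (Ω ∖ walkEdges w) v ≡ boundary a b v xor oddDegree Ω v
  oddDegree-∖-trail Ω (nil a) [] [] v = begin
    oddDegree (Ω ∖ []) v          ≡⟨ oddDegree-cong (λ e → ∧-identityʳ (Ω e)) v ⟩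
    oddDegree Ω v                 ≡⟨ cong (_xor oddDegree Ω v) (boundary-refl a v) ⟨
    boundary a a v xor oddDegree Ω v ∎
    where open ≡-Reasoning
  oddDegree-∖-trail Ω {a} {b} (cons {z = z} e j w) (e∉w ∷ unique) (Ωe ∷ within) v = begin
    oddDegree (Ω ∖ (e ∷ walkEdges w)) v
      ≡⟨ oddDegree-cong (∖-∷ Ω (walkEdges w) Ωe (All¬⇒¬Any e∉w)) v ⟩
    oddDegree (toggle e (Ω ∖ walkEdges w)) v
      ≡⟨ oddDegree-toggle e (Ω ∖ walkEdges w) v ⟩
    incidence e v xor oddDegree (Ω ∖ walkEdges w) v
      ≡⟨ cong₂ _xor_ (incidence-joins j v) (oddDegree-∖-trail Ω w unique within v) ⟩
    boundary a z v xor (boundary z b v xor oddDegree Ω v)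
      ≡⟨ xor-assoc (boundary a z v) (boundary z b v) (oddDegree Ω v) ⟨
    (boundary a z v xor boundary z b v) xor oddDegree Ω v
      ≡⟨ cong (_xor oddDegree Ω v) (boundary-trans a z b v) ⟩
    boundary a b v xor oddDegree Ω v ∎
    where open ≡-Reasoning

  record Trail (Ω : EdgeSet) (a b : Vertex G) : Set where
    field
      walk   : Walk G a b
      unique : Unique (walkEdges walk)
      within : All (In Ω) (walkEdges walk)

    edges : List (Edge G)
    edges = walkEdges walk

  open Trail

  even-∖-circuit : ∀ {Ω a} → Even Ω → (C : Trail Ω a a) → Even (Ω ∖ edges C)
  even-∖-circuit {Ω} {a} even C v = begin
    oddDegree (Ω ∖ edges C) v           ≡⟨ oddDegree-∖-trail Ω (walk C) (unique C) (within C) v ⟩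
    boundary a a v xor oddDegree Ω v    ≡⟨ cong₂ _xor_ (boundary-refl a v) (even v) ⟩
    false                               ∎
    where open ≡-Reasoning

  close-trail : ∀ {F c} → Even F → ∀ {x e₀} → (W : Trail F x c) → e₀ ∈ edges W →
    Σ (Trail F c c) λ D → e₀ ∈ edges D
  close-trail {F} {c} even {x₀} {e₀} W₀ e₀∈W₀ = descent μ extend (x₀ , W₀ , e₀∈W₀)
    where
    OpenTrail : Set
    OpenTrail = Σ (Vertex G) λ x → Σ (Trail F x c) λ W → e₀ ∈ edges W

    μ : OpenTrail → ℕ
    μ (_ , W , _) = count (F ∖ edges W)

    extend : (o : OpenTrail) → (Σ (Trail F c c) λ D → e₀ ∈ edges D) ⊎ Σ OpenTrail λ o′ → μ o′ < μ o
    extend (x , W , e₀∈W) with x ≟ c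
    ... | yes refl = inj₁ (W , e₀∈W)
    ... | no x≢c
      with parity-true⇒∃ (λ e → (F ∖ edges W) e ∧ incidence e x) odd-at-x
      where
      odd-at-x : oddDegree (F ∖ edges W) x ≡ true
      odd-at-x = begin
        oddDegree (F ∖ edges W) x           ≡⟨ oddDegree-∖-trail F (walk W) (unique W) (within W) x ⟩
        boundary x c x xor oddDegree F x    ≡⟨ cong₂ _xor_ (boundary-source x≢c) (even x) ⟩
        true                                ∎
        where open ≡-Reasoning
    ... | e , unused∧incident
      with incidence-true⇒joins e x (∧-conicalʳ _ _ unused∧incident)
    ... | y , j = inj₂ ((y , W′ , there e₀∈W) , shrinks)
      where
      unused : (F ∖ edges W) e ≡ true
      unused = ∧-conicalˡ _ _ unused∧incident

      W′ : Trail F y c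
      W′ = record
        { walk   = cons e (joins-sym j) (walk W)
        ; unique = ¬Any⇒All¬ _ (proj₂ (∖-true⇒ F (edges W) unused)) ∷ unique W
        ; within = proj₁ (∖-true⇒ F (edges W) unused) ∷ within W
        }

      shrinks : count (F ∖ edges W′) < count (F ∖ edges W)
      shrinks = count-strict e (∖-antitone F (edges W′) there) (∖-∈ F (edges W′) (here refl)) unused

  Exit : EdgeSet → ∀ {a b} → Walk G a b → Set
  Exit F C = ∃[ c ] ∃[ e ] ∃[ y ] c ∈ walkVertices C × (F ∖ walkEdges C) e ≡ true × Joins G e c y

  stay-or-exit : ∀ {F a b x t} (C : Walk G a b) → x ∈ walkVertices C →
    (w : Walk G x t) → All (In F) (walkEdges w) → t ∈ walkVertices C ⊎ Exit F C
  stay-or-exit C x∈C (nil _) [] = inj₁ x∈C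
  stay-or-exit {F} {x = x} C x∈C (cons d j w) (Fd ∷ Fw) with d ∈? walkEdges C
  ... | yes d∈C = stay-or-exit C (endpoint∈walkVertices C d∈C j) w Fw
  ... | no d∉C  = inj₂ (x , d , _ , x∈C , ∖-intro F (walkEdges C) Fd d∉C , j)

  splice-trail : ∀ {Ω a b c} (C : Trail Ω a b) → c ∈ walkVertices (walk C) →
    (D : Trail (Ω ∖ edges C) c c) →
    Σ (Trail Ω a b) λ C′ → edges C′ ↭ edges D ++ edges C
  splice-trail {Ω} C c∈C D with splice (walk C) c∈C (walk D)
  ... | w′ , w′↭ = C′ , w′↭
    where
    fresh : ∀ {e} → e ∈ edges D → Ω e ≡ true × e ∉ edges C
    fresh e∈D = ∖-true⇒ Ω (edges C) (All.lookup (within D) e∈D)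

    C′ : Trail Ω _ _
    C′ = record
      { walk   = w′
      ; unique = Unique-resp-↭ (↭⇒↭ₛ (↭-sym w′↭))
                   (Unique.++⁺ (unique D) (unique C) λ (e∈D , e∈C) → proj₂ (fresh e∈D) e∈C)
      ; within = All-resp-↭ (↭-sym w′↭) (++⁺ (All.tabulate (proj₁ ∘ fresh)) (within C))
      }

  grow-circuit : ∀ {Ω r} → Even Ω → (C : Trail Ω r r) → Exit Ω (walk C) →
    Σ (Trail Ω r r) λ C′ → count (Ω ∖ edges C′) < count (Ω ∖ edges C)
  grow-circuit {Ω} even C (c , e , y , c∈C , unused , j)
    with close-trail (even-∖-circuit even C) edge (here refl)
    where
    edge : Trail (Ω ∖ edges C) y c
    edge = record { walk = cons e (joins-sym j) (nil c) ; unique = [] ∷ [] ; within = unused ∷ [] }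
  ... | D , e∈D with splice-trail C c∈C D
  ... | C′ , C′↭ = C′ , count-strict e (∖-antitone Ω (edges C′) (∈C′ ∘ ∈-++⁺ʳ (edges D)))
                                      (∖-∈ Ω (edges C′) (∈C′ (∈-++⁺ˡ e∈D))) unused
    where
    ∈C′ : ∀ {e′} → e′ ∈ edges D ++ edges C → e′ ∈ edges C′
    ∈C′ = ∈-resp-↭ (↭-sym C′↭)

  covering-circuit-spans : ∀ {Ω r} (C : Trail Ω r r) → (∀ e → Ω e ≡ true → e ∈ edges C) →
    (∀ v → WalkIn (In Ω) r v) → ∀ v → v ∈ walkVertices (walk C)
  covering-circuit-spans {Ω} C complete reach v with reach v
  ... | w , Ωw with stay-or-exit (walk C) (source∈walkVertices (walk C)) w Ωw
  ... | inj₁ v∈C = v∈C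
  ... | inj₂ (_ , e , _ , _ , unused , _) = contradiction (complete e Ωe) e∉C
    where
    Ωe  = proj₁ (∖-true⇒ Ω (edges C) unused)
    e∉C = proj₂ (∖-true⇒ Ω (edges C) unused)

  euler-circuit : ∀ {Ω r} → Even Ω → (∀ v → WalkIn (In Ω) r v) →
    Σ (Trail Ω r r) λ C → ∀ e → Ω e ≡ true → e ∈ edges C
  euler-circuit {Ω} {r} even reach = descent (λ C → count (Ω ∖ edges C)) step empty
    where
    empty : Trail Ω r r
    empty = record { walk = nil r ; unique = [] ; within = [] }

    step : (C : Trail Ω r r) → (Σ (Trail Ω r r) λ C → ∀ e → Ω e ≡ true → e ∈ edges C)
                              ⊎ Σ (Trail Ω r r) λ C′ → count (Ω ∖ edges C′) < count (Ω ∖ edges C)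
    step C with any? (λ e → (Ω ∖ edges C) e ≟ᵇ true)
    ... | yes (e , unused) = inj₂ (grow-circuit even C exit)
      where
      exit : Exit Ω (walk C)
      exit with reach (proj₁ (ends G e))
      ... | w , Ωw with stay-or-exit (walk C) (source∈walkVertices (walk C)) w Ωw
      ... | inj₁ e-on-C = _ , e , _ , e-on-C , unused , ends-joins e
      ... | inj₂ exit   = exit
    ... | no none = inj₁ (C , covered)
      where
      covered : ∀ e → Ω e ≡ true → e ∈ edges C
      covered e Ωe with e ∈? edges C
      ... | yes e∈C = e∈C
      ... | no e∉C  = contradiction (e , ∖-intro Ω (edges C) Ωe e∉C) none


module Triangles (G : Graph) where

  open Eulerian G

  module _ {e : Edge G} where

    first second : TriangleOn G e → Edge G
    first  t = proj₁ (proj₁ t)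
    second t = proj₂ (proj₁ t)

  AvoidingTriangle : EdgeSet → Edge G → Set
  AvoidingTriangle B e = Σ (TriangleOn G e) λ t → B (first t) ≡ false × B (second t) ≡ false

  avoiding-detour : ∀ {B e} → AvoidingTriangle B e →
    WalkIn (λ f → B f ≡ false) (proj₁ (ends G e)) (proj₂ (ends G e))
  avoiding-detour (((f , g) , w , jf , jg) , f∉B , g∉B) =
    cons f jf (cons g (joins-sym jg) (nil _)) , f∉B ∷ g∉B ∷ []

  module _ (loopless : Loopless G) where

    no-loop : ∀ {f a} → ¬ Joins G f a a
    no-loop {f} (inj₁ (f₁≡a , f₂≡a)) = loopless f (trans f₁≡a (sym f₂≡a))
    no-loop {f} (inj₂ (f₁≡a , f₂≡a)) = loopless f (trans f₁≡a (sym f₂≡a))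

    module _ {e : Edge G} where

      first≢second : (t t′ : TriangleOn G e) → first t ≢ second t′
      first≢second ((f , g) , w , jf , jg) ((f′ , .f) , w′ , jf′ , jg′) refl with joins-endpoints jf jg′
      ... | inj₁ (p≡q , _) = loopless e p≡q
      ... | inj₂ (_ , refl) = no-loop jg

      first≢base : (t : TriangleOn G e) → first t ≢ e
      first≢base ((f , g) , w , jf , jg) refl with joins-endpoints jf (ends-joins e)
      ... | inj₁ (_ , refl) = no-loop jg
      ... | inj₂ (p≡q , _)  = loopless e p≡q

      second≢base : (t : TriangleOn G e) → second t ≢ e
      second≢base ((f , g) , w , jf , jg) refl with joins-endpoints jg (ends-joins e)
      ... | inj₁ (q≡p , _)  = loopless e (sym q≡p)
      ... | inj₂ (_ , refl) = no-loop jf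

    module _ (simple : Simple G) where

      joins-injective : ∀ {f f′ a b} → Joins G f a b → Joins G f′ a b → f ≡ f′
      joins-injective {f} {f′} (inj₁ (refl , refl)) j′ = simple f f′ j′
      joins-injective {f} {f′} (inj₂ (refl , refl)) j′ = simple f f′ (joins-sym j′)

      module _ {e : Edge G} where

        first-injective : (t t′ : TriangleOn G e) → first t ≡ first t′ → proj₁ t ≡ proj₁ t′
        first-injective ((f , g) , w , jf , jg) ((.f , g′) , w′ , jf′ , jg′) refl
          with joins-endpoints jf jf′
        ... | inj₁ (_ , refl) = cong (f ,_) (joins-injective jg jg′)
        ... | inj₂ (_ , refl) = contradiction jf no-loop

        second-injective : (t t′ : TriangleOn G e) → second t ≡ second t′ → proj₁ t ≡ proj₁ t′
        second-injective ((f , g) , w , jf , jg) ((f′ , .g) , w′ , jf′ , jg′) refl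
          with joins-endpoints jg jg′
        ... | inj₁ (_ , refl) = cong (_, g) (joins-injective jf jf′)
        ... | inj₂ (_ , refl) = contradiction jg no-loop

        avoiding-triangle : ∀ {k} (T : Fin k → TriangleOn G e) → Injective _≡_ _≡_ (proj₁ ∘ T) →
          (B : EdgeSet) → count B < k → AvoidingTriangle B e
        avoiding-triangle {k} T T-injective B few
          with any? (λ i → (B (first (T i)) ∨ B (second (T i))) ≟ᵇ false)
        ... | yes (i , free) = T i , ∨-conicalˡ _ _ free , ∨-conicalʳ _ _ free
        ... | no blocked = contradiction (count-injection hit hit-injective hit∈B) (<⇒≱ few)
          where
          hit : Fin k → Edge G
          hit i = if B (first (T i)) then first (T i) else second (T i)

          hit∈B : ∀ i → B (hit i) ≡ true
          hit∈B i with B (first (T i)) in first∈B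
          ... | true  = first∈B
          ... | false = ¬-not λ second∉B → blocked (i , cong₂ _∨_ first∈B second∉B)

          hit-injective : ∀ {i j} → hit i ≡ hit j → i ≡ j
          hit-injective {i} {j} eq with B (first (T i)) | B (first (T j))
          ... | true  | true  = T-injective (first-injective (T i) (T j) eq)
          ... | true  | false = contradiction eq (first≢second (T i) (T j))
          ... | false | true  = contradiction (sym eq) (first≢second (T j) (T i))
          ... | false | false = T-injective (second-injective (T i) (T j) eq)

module ParityRepair {G : Graph} (loopless : Loopless G) (X Y : Eulerian.EdgeSet G) (r : Vertex G)
  (avoiding : ∀ e → Triangles.AvoidingTriangle G (λ f → X f ∨ Y f) e) where

  open Eulerian G
  open Triangles G

  Free : Edge G → Set
  Free e = X e ∨ Y e ≡ false

  free-walk : ∀ {a b} → Walk G a b → WalkIn Free a b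
  free-walk (nil a) = nil a , []
  free-walk (cons e j w) with X e ∨ Y e in fixed | free-walk w
  ... | false | rest = (cons e j (nil _) , fixed ∷ []) ++ᵂ rest
  ... | true  | rest with joins-endpoints j (ends-joins e)
  ...   | inj₁ (refl , refl) = avoiding-detour (avoiding e) ++ᵂ rest
  ...   | inj₂ (refl , refl) = reverseᵂ (avoiding-detour (avoiding e)) ++ᵂ rest

  record Admissible (Ω : EdgeSet) : Set where
    field
      reaches : ∀ v → WalkIn (In Ω) r v
      avoids  : ∀ e → Ω e ≡ true → Y e ≡ false
      covers  : ∀ e → X e ≡ true → Ω e ≡ true

  open Admissible
  open Trail

  module _ {Ω i} (free : Free i) (adm : Admissible Ω) where

    toggle-avoids : ∀ e → toggle i Ω e ≡ true → Y e ≡ false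
    toggle-avoids e toggled with e ≟ i
    ... | yes refl = ∨-conicalʳ (X i) (Y i) free
    ... | no e≢i   = avoids adm e (trans (sym (toggle-other Ω (e≢i ∘ sym))) toggled)

    toggle-covers : ∀ e → X e ≡ true → toggle i Ω e ≡ true
    toggle-covers e Xe = toggle-keeps i Ω (covers adm e Xe) e≢i
      where
      e≢i : e ≢ i
      e≢i refl = contradiction (trans (sym Xe) (∨-conicalˡ (X i) (Y i) free)) λ ()

    add-edge : Ω i ≡ false → Admissible (toggle i Ω)
    add-edge Ωi = record
      { reaches = λ v → map₂ (All.map kept) (reaches adm v)
      ; avoids  = toggle-avoids
      ; covers  = toggle-covers
      }
      where
      kept : ∀ {e} → Ω e ≡ true → toggle i Ω e ≡ true
      kept {e} Ωe = toggle-keeps i Ω Ωe λ { refl → contradiction (trans (sym Ωe) Ωi) λ () }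

    remove-edge : ∀ {a b} → Joins G i a b → WalkIn (In (toggle i Ω)) a b → Admissible (toggle i Ω)
    remove-edge ji detour = record
      { reaches = λ v → reroute ji detour (λ _ → toggle-keeps i Ω) (reaches adm v)
      ; avoids  = toggle-avoids
      ; covers  = toggle-covers
      }

  ParityShift : EdgeSet → (Vertex G → Bool) → EdgeSet → Set
  ParityShift Ω δ Ω′ = ∀ v → oddDegree Ω′ v ≡ δ v xor oddDegree Ω v

  Shifted : EdgeSet → (Vertex G → Bool) → Set
  Shifted Ω δ = Σ EdgeSet λ Ω′ → Admissible Ω′ × ParityShift Ω δ Ω′

  shift-trans : ∀ {Ω Ω₁ Ω₂ δ₁ δ₂} → ParityShift Ω δ₁ Ω₁ → ParityShift Ω₁ δ₂ Ω₂ →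
    ParityShift Ω (λ v → δ₂ v xor δ₁ v) Ω₂
  shift-trans {Ω} {δ₁ = δ₁} {δ₂} shift₁ shift₂ v =
    trans (shift₂ v) (trans (cong (δ₂ v xor_) (shift₁ v))
                            (sym (xor-assoc (δ₂ v) (δ₁ v) (oddDegree Ω v))))

  shift-cong : ∀ {Ω Ω′ δ δ′} → (∀ v → δ v ≡ δ′ v) → ParityShift Ω δ Ω′ → ParityShift Ω δ′ Ω′
  shift-cong {Ω} δ≗δ′ shift v = trans (shift v) (cong (_xor oddDegree Ω v) (δ≗δ′ v))

  shift-along-edge : ∀ {Ω e} → Free e → Admissible Ω → Shifted Ω (incidence e)
  shift-along-edge {Ω} {e} free-e adm with avoiding e
  ... | t@((f , g) , w , jf , jg) , free-f , free-g = by-membership (Ω e) (Ω f) (Ω g) refl refl refl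
    where
    p q : Vertex G
    p = proj₁ (ends G e)
    q = proj₂ (ends G e)

    f≢e : f ≢ e
    f≢e = first≢base loopless t
    g≢e : g ≢ e
    g≢e = second≢base loopless t
    f≢g : f ≢ g
    f≢g = first≢second loopless t t

    triangle-parity : ∀ v → incidence f v xor incidence g v ≡ incidence e v
    triangle-parity v =
      trans (cong₂ _xor_ (incidence-joins jf v) (trans (incidence-joins jg v) (boundary-comm q w v)))
            (boundary-trans p w q v)

    shift-fg : ParityShift Ω (incidence e) (toggle f (toggle g Ω))
    shift-fg = shift-cong triangle-parity
      (shift-trans {δ₁ = incidence g} {incidence f}
                   (oddDegree-toggle g Ω) (oddDegree-toggle f (toggle g Ω)))

    shift-gf : ParityShift Ω (incidence e) (toggle g (toggle f Ω))
    shift-gf = shift-cong (λ v → trans (xor-comm (incidence g v) (incidence f v)) (triangle-parity v))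
      (shift-trans {δ₁ = incidence f} {incidence g}
                   (oddDegree-toggle f Ω) (oddDegree-toggle g (toggle f Ω)))

    -- Toggling e changes degree parities exactly at the ends of e, and so does toggling both f
    -- and g.  The toggles are chosen so that every removed edge has a detour in the new edge set.
    by-membership : ∀ ωe ωf ωg → Ω e ≡ ωe → Ω f ≡ ωf → Ω g ≡ ωg → Shifted Ω (incidence e)
    by-membership false _ _ Ωe _ _ = toggle e Ω , add-edge free-e adm Ωe , oddDegree-toggle e Ω
    by-membership true true true Ωe Ωf Ωg =
      toggle e Ω , remove-edge free-e adm (ends-joins e) detour , oddDegree-toggle e Ω
      where
      detour : WalkIn (In (toggle e Ω)) p q
      detour = cons f jf (cons g (joins-sym jg) (nil q)) ,
               toggle-keeps e Ω Ωf f≢e ∷ toggle-keeps e Ω Ωg g≢e ∷ []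
    by-membership true true false Ωe Ωf Ωg =
      toggle f Ω₁ , remove-edge free-f (add-edge free-g adm Ωg) jf detour , shift-fg
      where
      Ω₁ = toggle g Ω
      detour : WalkIn (In (toggle f Ω₁)) p w
      detour = cons e (ends-joins e) (cons g jg (nil w)) ,
               toggle-keeps f Ω₁ (toggle-keeps g Ω Ωe (g≢e ∘ sym)) (f≢e ∘ sym) ∷
               toggle-keeps f Ω₁ (trans (toggle-self g Ω) (cong not Ωg)) (f≢g ∘ sym) ∷ []
    by-membership true false true Ωe Ωf Ωg =
      toggle g Ω₁ , remove-edge free-g (add-edge free-f adm Ωf) jg detour , shift-gf
      where
      Ω₁ = toggle f Ω
      detour : WalkIn (In (toggle g Ω₁)) q w
      detour = cons e (joins-sym (ends-joins e)) (cons f jf (nil w)) ,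
               toggle-keeps g Ω₁ (toggle-keeps f Ω Ωe (f≢e ∘ sym)) (g≢e ∘ sym) ∷
               toggle-keeps g Ω₁ (trans (toggle-self f Ω) (cong not Ωf)) f≢g ∷ []
    by-membership true false false Ωe Ωf Ωg =
      toggle f (toggle g Ω) ,
      add-edge free-f (add-edge free-g adm Ωg) (toggle-other Ω (f≢g ∘ sym) ⟨ trans ⟩ Ωf) ,
      shift-fg

  shift-along-walk : ∀ {Ω a b} (w : Walk G a b) → All Free (walkEdges w) → Admissible Ω →
    Shifted Ω (boundary a b)
  shift-along-walk {Ω} (nil a) [] adm =
    Ω , adm , λ v → cong (_xor oddDegree Ω v) (sym (boundary-refl a v))
  shift-along-walk {Ω} {a} {b} (cons {z = z} e j w) (free-e ∷ free-w) adm
    with shift-along-edge free-e adm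
  ... | Ω₁ , adm₁ , shift₁ with shift-along-walk w free-w adm₁
  ... | Ω₂ , adm₂ , shift₂ =
    Ω₂ , adm₂ , shift-cong telescope (shift-trans {δ₁ = incidence e} {boundary z b} shift₁ shift₂)
    where
    telescope : ∀ v → boundary z b v xor incidence e v ≡ boundary a b v
    telescope v = begin
      boundary z b v xor incidence e v   ≡⟨ xor-comm (boundary z b v) (incidence e v) ⟩
      incidence e v xor boundary z b v   ≡⟨ cong (_xor boundary z b v) (incidence-joins j v) ⟩
      boundary a z v xor boundary z b v  ≡⟨ boundary-trans a z b v ⟩
      boundary a b v                     ∎
      where open ≡-Reasoning

  make-even : Connected G → ∀ {Ω} → Admissible Ω → Σ EdgeSet λ Ω′ → Admissible Ω′ × Even Ω′
  make-even connected {Ω₀} adm₀ = descent (λ (Ω , _) → count (oddDegree Ω)) step (Ω₀ , adm₀)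
    where
    step : (s : Σ EdgeSet Admissible) → (Σ EdgeSet λ Ω′ → Admissible Ω′ × Even Ω′)
           ⊎ Σ (Σ EdgeSet Admissible) λ s′ → count (oddDegree (proj₁ s′)) < count (oddDegree (proj₁ s))
    step (Ω , adm) with any? (λ v → oddDegree Ω v ≟ᵇ true)
    ... | no all-even = inj₁ (Ω , adm , λ v → ¬-not λ odd → all-even (v , odd))
    ... | yes (p , odd-p) with parity-false⇒another (oddDegree Ω) (handshake Ω) odd-p
    ... | q , q≢p , odd-q with free-walk (connected p q)
    ... | w , free-w with shift-along-walk w free-w adm
    ... | Ω′ , adm′ , shift =
      inj₂ ((Ω′ , adm′) ,
            (≤-reflexive (cong suc (count-cong shift)) ⟨ ≤-trans ⟩ count-boundary-xor q≢p odd-p odd-q))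

  initial : Connected G → (∀ e → X e ≡ true → Y e ≡ false) → Admissible (not ∘ Y)
  initial connected X⇒¬Y = record
    { reaches = λ v → map₂ (All.map λ {e} → cong not ∘ ∨-conicalʳ (X e) (Y e)) (free-walk (connected r v))
    ; avoids  = λ e ¬Y → trans (sym (not-involutive (Y e))) (cong not ¬Y)
    ; covers  = λ e Xe → cong not (X⇒¬Y e Xe)
    }

  spanning-closed-trail : Connected G → (∀ e → X e ≡ true → Y e ≡ false) →
    Σ (Walk G r r) λ C → Unique (walkEdges C) × All (λ e → Y e ≡ false) (walkEdges C)
                       × (∀ v → v ∈ walkVertices C) × (∀ e → X e ≡ true → e ∈ walkEdges C)
  spanning-closed-trail connected X⇒¬Y with make-even connected (initial connected X⇒¬Y)
  ... | Ω , adm , even with euler-circuit even (reaches adm)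
  ... | C , complete =
    walk C , unique C , All.map (λ {e} → avoids adm e) (within C) ,
    covering-circuit-spans C complete (reaches adm) , λ e → complete e ∘ covers adm e


count-lookup : ∀ {n} (X : Subset n) → count (lookup X) ≡ ∣ X ∣
count-lookup []          = refl
count-lookup (true ∷ X)  = cong suc (count-lookup X)
count-lookup (false ∷ X) = count-lookup X

count-∨-lookup : ∀ {n s t} (X Y : Subset n) → ∣ X ∣ ≤ s → ∣ Y ∣ ≤ t →
  count (λ e → lookup X e ∨ lookup Y e) < s + t + 1
count-∨-lookup {s = s} {t} X Y ∣X∣≤s ∣Y∣≤t = begin-strict
  count (λ e → lookup X e ∨ lookup Y e)   ≤⟨ count-∨ (lookup X) (lookup Y) ⟩
  count (lookup X) + count (lookup Y)     ≡⟨ cong₂ _+_ (count-lookup X) (count-lookup Y) ⟩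
  ∣ X ∣ + ∣ Y ∣                           ≤⟨ +-mono-≤ ∣X∣≤s ∣Y∣≤t ⟩
  s + t                                   <⟨ n<1+n (s + t) ⟩
  suc (s + t)                             ≡⟨ +-comm 1 (s + t) ⟩
  s + t + 1                               ∎
  where open ≤-Reasoning

has-vertex : (G : Graph) → ¬ Iso G (pathG 0) → Vertex G
has-vertex G not-null = inhabited (nV G) (not-null ∘ null)
  where
  empty-bijection : {A : Set} → ¬ A → A ⤖ Fin 0
  empty-bijection ¬a = mk⤖ {to = ⊥-elim ∘ ¬a} ((λ {a} _ → ⊥-elim (¬a a)) , λ ())

  null : ¬ Vertex G → Iso G (pathG 0)
  null no-vertex = record
    { vmap      = empty-bijection no-vertex
    ; emap      = empty-bijection (no-vertex ∘ proj₁ ∘ ends G)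
    ; incidence = ⊥-elim ∘ no-vertex ∘ proj₁ ∘ ends G
    }

  inhabited : ∀ n → ¬ ¬ Fin n → Fin n
  inhabited zero    ¬¬fin = ⊥-elim (¬¬fin λ ())
  inhabited (suc n) _     = zero

lemma4p2 : (s t : ℕ) (G : Graph) → InFamily G → Simple G →
    Triangular (s + t + 1) G → Supereulerian s t G
lemma4p2 s t G (loopless , connected , not-path , _) simple triangular X Y disjoint ∣X∣≤s ∣Y∣≤t =
  case spanning-closed-trail connected X⇒¬Y of λ (C , unique , avoids-Y , spans , covers-X) →
    r , C , unique , All.map (λ ¬Y e∈Y → not-¬ ¬Y ([]=⇒lookup e∈Y)) avoids-Y , spans ,
    λ e → covers-X e ∘ []=⇒lookup
  where
  r : Vertex G
  r = has-vertex G (not-path 0)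

  open ParityRepair loopless (lookup X) (lookup Y) r (λ e →
    Triangles.avoiding-triangle G loopless simple (proj₁ (triangular e)) (proj₂ (triangular e)) _
      (count-∨-lookup X Y ∣X∣≤s ∣Y∣≤t))

  X⇒¬Y : ∀ e → lookup X e ≡ true → lookup Y e ≡ false
  X⇒¬Y e Xe = ¬-not λ Ye → disjoint e (lookup⇒[]= e X Xe) (lookup⇒[]= e Y Ye)
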